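{- Let $P=u,w,v$ be a path of length $2$ and $L$ an $m$-assignment for $P$ with $m\ge 3$. For $c\in L(u)$, $d\in L(v)$ let $N(c,d)$ be the number of proper colorings $f$ of $P$ with $f(x)\in L(x)$ for all $x$, $f(u)=c$, $f(v)=d$. Let $a=|L(u)\cap L(v)|$. Then (i) $m-2\le N(c,d)\le m$ for all $c\in L(u)$, $d\in L(v)$; and (ii) the number of ordered pairs $(c,d)\in L(u)\times L(v)$ with $N(c,d)=m-2$ is at most $\frac{(a+m)^2}{4}-a$.
   Context: An $m$-assignment $L$ assigns to each vertex a set $L(x)$ of $m$ colors. -}

module Defs where

open import Data.Nat using (ℕ; _≟_; _∸_)
open import Data.Bool using (Bool; true; false; T)
open import Data.Fin using (Fin; zero; suc)
open import Data.Fin.Properties using (all?)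
open import Data.List using (List; length; filter; cartesianProduct)
open import Data.List.Relation.Unary.Unique.Propositional using (Unique)
open import Data.List.Membership.DecPropositional _≟_ using (_∈?_)
open import Data.Product using (_×_; _,_)
open import Relation.Nullary using (¬_; Dec; ¬?; _→-dec_)
open import Relation.Nullary.Decidable using (T?)
open import Relation.Binary.PropositionalEquality using (_≡_; _≢_)

Vertex : Set
Vertex = Fin 3

u w v : Vertex
u = zero
w = suc zero
v = suc (suc zero)

adj : Vertex → Vertex → Bool
adj zero (suc zero) = true
adj (suc zero) zero = true
adj (suc zero) (suc (suc zero)) = true
adj (suc (suc zero)) (suc zero) = true
adj _ _ = false

Adj : Vertex → Vertex → Set
Adj x y = T (adj x y)

Coloring : Set
Coloring = Vertex → ℕ

IsProper : Coloring → Set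
IsProper f = ∀ x y → Adj x y → f x ≢ f y

isProper? : (f : Coloring) → Dec (IsProper f)
isProper? f = all? (λ x → all? (λ y → T? (adj x y) →-dec ¬? (f x ≟ f y)))

ListAssignment : Set
ListAssignment = Vertex → List ℕ

IsMAssignment : ℕ → ListAssignment → Set
IsMAssignment m L = ∀ x → Unique (L x) × length (L x) ≡ m

col : ℕ → ℕ → ℕ → Coloring
col c e d zero = c
col c e d (suc zero) = e
col c e d (suc (suc zero)) = d

-- N(c,d): the number of proper L-colourings f of P with f(u) = c, f(v) = d.
-- Such an f is determined by f(w) ∈ L(w), so we count the (distinct) e ∈ L(w)
-- for which col c e d is proper.
N : ListAssignment → ℕ → ℕ → ℕ
N L c d = length (filter (λ e → isProper? (col c e d)) (L w))

commonCount : ListAssignment → ℕ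
commonCount L = length (filter (λ c → c ∈? L v) (L u))

badPairs : ℕ → ListAssignment → ℕ
badPairs m L =
  length (filter (λ p → N L (Data.Product.proj₁ p) (Data.Product.proj₂ p) ≟ m ∸ 2)
                 (cartesianProduct (L u) (L v)))

{-# OPTIONS --safe #-}
-- A colouring with f(u) = c and f(v) = d is proper exactly when f(w) ∈ L(w) ∖ {c, d}, so
-- N(c,d) = m − |{c, d} ∩ L(w)|. This gives (i), and shows that N(c,d) = m − 2 exactly when
-- c ≠ d and c, d ∈ L(w). Writing A = L(u), B = L(v), W = L(w), x = |A ∩ W|, y = |B ∩ W| and
-- z = |A ∩ B ∩ W|, there are therefore xy − z bad pairs, while inclusion–exclusion inside W
-- gives x + y ≤ m + z, and z ≤ a. Hence, by AM–GM,
--   4 (xy − z + a) ≤ (x + y)² + 4 (a − z) ≤ (m + z)² + 4 (a − z) ≤ (m + a)²,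
-- the last step because m ≥ 2. Only |L(w)| = m ≥ 2 and the distinctness of the colours in
-- each list are used.
module Submission where

open import Defs
open import Level using (Level)
open import Data.Nat using (ℕ; _≤_; _+_; _*_; _∸_; _≟_; z≤n; s≤s)
open import Data.Nat.Properties
open import Data.Nat.Tactic.RingSolver using (solve-∀)
open import Data.Fin using (zero; suc)
open import Data.Product using (_×_; _,_; proj₁; proj₂)
open import Data.Sum using ([_,_]′)
open import Data.Empty using (⊥-elim)
open import Data.Unit using (tt)
open import Function using (_∘_)
open import Data.List using (List; []; _∷_; length; filter; map; _++_; cartesianProduct)
open import Data.List.Membership.Propositional using (_∈_; _∉_)
open import Data.List.Relation.Unary.Any using (here; there)
open import Data.List.Relation.Unary.All.Properties using (All¬⇒¬Any)
open import Data.List.Relation.Unary.AllPairs using (_∷_)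
open import Data.List.Relation.Unary.Unique.Propositional using (Unique)
open import Relation.Nullary using (Dec; yes; no; ¬_)
open import Relation.Unary using (Pred; Decidable)
open import Relation.Binary.Definitions using (DecidableEquality)
open import Relation.Binary.PropositionalEquality
open import Algebra.Properties.CommutativeSemigroup +-commutativeSemigroup
  using () renaming (interchange to +-interchange)

private
  variable
    a b p q : Level
    A : Set a
    B : Set b
    P : Set p
    Q : Set q

𝟙 : Dec P → ℕ
𝟙 (yes _) = 1
𝟙 (no _)  = 0

𝟙-yes : (P? : Dec P) → P → 𝟙 P? ≡ 1
𝟙-yes (yes _) _  = refl
𝟙-yes (no ¬p) p = ⊥-elim (¬p p)

𝟙-no : (P? : Dec P) → ¬ P → 𝟙 P? ≡ 0
𝟙-no (yes p) ¬p = ⊥-elim (¬p p)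
𝟙-no (no _)  _  = refl

𝟙≤1 : (P? : Dec P) → 𝟙 P? ≤ 1
𝟙≤1 (yes _) = s≤s z≤n
𝟙≤1 (no _)  = z≤n

𝟙-cong : (P → Q) → (Q → P) → (P? : Dec P) (Q? : Dec Q) → 𝟙 P? ≡ 𝟙 Q?
𝟙-cong P⇒Q Q⇒P (yes p) Q? = sym (𝟙-yes Q? (P⇒Q p))
𝟙-cong P⇒Q Q⇒P (no ¬p) Q? = sym (𝟙-no Q? (¬p ∘ Q⇒P))

𝟙+𝟙≤1+𝟙*𝟙 : (P? : Dec P) (Q? : Dec Q) → 𝟙 P? + 𝟙 Q? ≤ 1 + 𝟙 P? * 𝟙 Q?
𝟙+𝟙≤1+𝟙*𝟙 (yes _) (yes _) = ≤-refl
𝟙+𝟙≤1+𝟙*𝟙 (yes _) (no _)  = ≤-refl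
𝟙+𝟙≤1+𝟙*𝟙 (no _)  (yes _) = ≤-refl
𝟙+𝟙≤1+𝟙*𝟙 (no _)  (no _)  = z≤n

∑ : List A → (A → ℕ) → ℕ
∑ []       f = 0
∑ (x ∷ xs) f = f x + ∑ xs f

∑-syntax : List A → (A → ℕ) → ℕ
∑-syntax = ∑

infix 5 ∑-syntax
syntax ∑-syntax xs (λ x → e) = ∑[ x ∈ xs ] e

module _ {f g : A → ℕ} where

  ∑-cong : (xs : List A) → (∀ x → x ∈ xs → f x ≡ g x) → ∑ xs f ≡ ∑ xs g
  ∑-cong []       f≡g = refl
  ∑-cong (x ∷ xs) f≡g = cong₂ _+_ (f≡g x (here refl)) (∑-cong xs (λ y y∈xs → f≡g y (there y∈xs)))

  ∑-mono : (xs : List A) → (∀ x → f x ≤ g x) → ∑ xs f ≤ ∑ xs g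
  ∑-mono []       f≤g = z≤n
  ∑-mono (x ∷ xs) f≤g = +-mono-≤ (f≤g x) (∑-mono xs f≤g)

  ∑-+ : (xs : List A) → (∑[ x ∈ xs ] (f x + g x)) ≡ ∑ xs f + ∑ xs g
  ∑-+ []       = refl
  ∑-+ (x ∷ xs) = begin
    f x + g x + (∑[ y ∈ xs ] f y + g y) ≡⟨ cong (f x + g x +_) (∑-+ xs) ⟩
    f x + g x + (∑ xs f + ∑ xs g)       ≡⟨ +-interchange (f x) (g x) (∑ xs f) (∑ xs g) ⟩
    f x + ∑ xs f + (g x + ∑ xs g)       ∎
    where open ≡-Reasoning

module _ (f : A → ℕ) where

  ∑-*ˡ : (k : ℕ) (xs : List A) → (∑[ x ∈ xs ] k * f x) ≡ k * ∑ xs f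
  ∑-*ˡ k []       = sym (*-zeroʳ k)
  ∑-*ˡ k (x ∷ xs) = trans (cong (k * f x +_) (∑-*ˡ k xs)) (sym (*-distribˡ-+ k (f x) (∑ xs f)))

  ∑-*ʳ : (k : ℕ) (xs : List A) → (∑[ x ∈ xs ] f x * k) ≡ ∑ xs f * k
  ∑-*ʳ k xs = begin
    ∑[ x ∈ xs ] f x * k ≡⟨ ∑-cong xs (λ x _ → *-comm (f x) k) ⟩
    ∑[ x ∈ xs ] k * f x ≡⟨ ∑-*ˡ k xs ⟩
    k * ∑ xs f          ≡⟨ *-comm k (∑ xs f) ⟩
    ∑ xs f * k          ∎
    where open ≡-Reasoning

  ∑-++ : (xs ys : List A) → ∑ (xs ++ ys) f ≡ ∑ xs f + ∑ ys f
  ∑-++ []       ys = refl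
  ∑-++ (x ∷ xs) ys = trans (cong (f x +_) (∑-++ xs ys)) (sym (+-assoc (f x) (∑ xs f) (∑ ys f)))

∑-zero : (xs : List A) → (∑[ x ∈ xs ] 0) ≡ 0
∑-zero []       = refl
∑-zero (x ∷ xs) = ∑-zero xs

∑-one : (xs : List A) → (∑[ x ∈ xs ] 1) ≡ length xs
∑-one []       = refl
∑-one (x ∷ xs) = cong (1 +_) (∑-one xs)

∑-map : (f : B → ℕ) (g : A → B) (xs : List A) → ∑ (map g xs) f ≡ ∑[ x ∈ xs ] f (g x)
∑-map f g []       = refl
∑-map f g (x ∷ xs) = cong (f (g x) +_) (∑-map f g xs)

∑-cartesianProduct : (f : A × B → ℕ) (xs : List A) (ys : List B) →
  ∑ (cartesianProduct xs ys) f ≡ ∑[ x ∈ xs ] ∑[ y ∈ ys ] f (x , y)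
∑-cartesianProduct f []       ys = refl
∑-cartesianProduct f (x ∷ xs) ys = trans (∑-++ f (map (x ,_) ys) (cartesianProduct xs ys))
  (cong₂ _+_ (∑-map f (x ,_) ys) (∑-cartesianProduct f xs ys))

length-filter≡∑𝟙 : {P : Pred A p} (P? : Decidable P) (xs : List A) →
  length (filter P? xs) ≡ ∑[ x ∈ xs ] 𝟙 (P? x)
length-filter≡∑𝟙 P? []       = refl
length-filter≡∑𝟙 P? (x ∷ xs) with P? x
... | yes _ = cong (1 +_) (length-filter≡∑𝟙 P? xs)
... | no _  = length-filter≡∑𝟙 P? xs

module ListIntersections (_≟_ : DecidableEquality A) where
  open import Data.List.Membership.DecPropositional _≟_ using (_∈?_)

  ∣_∩_∣ : List A → List A → ℕ
  ∣ xs ∩ ys ∣ = ∑[ x ∈ xs ] 𝟙 (x ∈? ys)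

  ∣_∩_∩_∣ : List A → List A → List A → ℕ
  ∣ xs ∩ ys ∩ zs ∣ = ∑[ x ∈ xs ] 𝟙 (x ∈? ys) * 𝟙 (x ∈? zs)

  ∑-select : {xs : List A} → Unique xs → (x : A) (g : A → ℕ) →
    (∑[ y ∈ xs ] 𝟙 (y ≟ x) * g y) ≡ 𝟙 (x ∈? xs) * g x
  ∑-select {[]}     _             x g = refl
  ∑-select {y ∷ xs} (y∉xs ∷ uniq) x g with y ≟ x
  ... | no y≢x = begin
    (∑[ z ∈ xs ] 𝟙 (z ≟ x) * g z)
      ≡⟨ ∑-select uniq x g ⟩
    𝟙 (x ∈? xs) * g x
      ≡⟨ cong (_* g x) (𝟙-cong there x∈y∷xs⇒x∈xs (x ∈? xs) (x ∈? (y ∷ xs))) ⟩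
    𝟙 (x ∈? (y ∷ xs)) * g x ∎
    where
    open ≡-Reasoning
    x∈y∷xs⇒x∈xs : x ∈ y ∷ xs → x ∈ xs
    x∈y∷xs⇒x∈xs (here x≡y)  = ⊥-elim (y≢x (sym x≡y))
    x∈y∷xs⇒x∈xs (there x∈xs) = x∈xs
  ... | yes refl = begin
    1 * g y + (∑[ z ∈ xs ] 𝟙 (z ≟ y) * g z) ≡⟨ cong (1 * g y +_) rest≡0 ⟩
    1 * g y + 0                             ≡⟨ +-identityʳ (1 * g y) ⟩
    1 * g y                                 ≡⟨ cong (_* g y) (𝟙-yes (y ∈? (y ∷ xs)) (here refl)) ⟨
    𝟙 (y ∈? (y ∷ xs)) * g y                 ∎
    where
    open ≡-Reasoning
    rest≡0 : (∑[ z ∈ xs ] 𝟙 (z ≟ y) * g z) ≡ 0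
    rest≡0 = trans (∑-cong xs (λ z z∈xs → cong (_* g z) (𝟙-no (z ≟ y)
                                 (λ { refl → All¬⇒¬Any y∉xs z∈xs }))))
                   (∑-zero xs)

  count-≟ : {xs : List A} → Unique xs → (x : A) → (∑[ y ∈ xs ] 𝟙 (y ≟ x)) ≡ 𝟙 (x ∈? xs)
  count-≟ {xs} uniq x = begin
    (∑[ y ∈ xs ] 𝟙 (y ≟ x))     ≡⟨ ∑-cong xs (λ y _ → *-identityʳ (𝟙 (y ≟ x))) ⟨
    (∑[ y ∈ xs ] 𝟙 (y ≟ x) * 1) ≡⟨ ∑-select uniq x (λ _ → 1) ⟩
    𝟙 (x ∈? xs) * 1             ≡⟨ *-identityʳ (𝟙 (x ∈? xs)) ⟩
    𝟙 (x ∈? xs)                 ∎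
    where open ≡-Reasoning

  𝟙-∈-∷ : {x : A} {xs : List A} → x ∉ xs → (y : A) → 𝟙 (y ≟ x) + 𝟙 (y ∈? xs) ≡ 𝟙 (y ∈? (x ∷ xs))
  𝟙-∈-∷ {x} {xs} x∉xs y = split (y ≟ x) (y ∈? xs) (y ∈? (x ∷ xs))
    where
    split : (y≟x : Dec (y ≡ x)) (y∈?xs : Dec (y ∈ xs)) (y∈?x∷xs : Dec (y ∈ x ∷ xs)) →
      𝟙 y≟x + 𝟙 y∈?xs ≡ 𝟙 y∈?x∷xs
    split (yes refl) (yes y∈xs) _          = ⊥-elim (x∉xs y∈xs)
    split (yes refl) (no _)     (yes _)    = refl
    split (yes refl) (no _)     (no y∉x∷xs) = ⊥-elim (y∉x∷xs (here refl))
    split (no y≢x)   y∈?xs      y∈?x∷xs    = 𝟙-cong there y∈x∷xs⇒y∈xs y∈?xs y∈?x∷xs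
      where
      y∈x∷xs⇒y∈xs : y ∈ x ∷ xs → y ∈ xs
      y∈x∷xs⇒y∈xs (here y≡x)   = ⊥-elim (y≢x y≡x)
      y∈x∷xs⇒y∈xs (there y∈xs) = y∈xs

  ∑-∈?-swap : {xs ys : List A} → Unique xs → Unique ys → (g : A → ℕ) →
    (∑[ x ∈ xs ] 𝟙 (x ∈? ys) * g x) ≡ (∑[ y ∈ ys ] 𝟙 (y ∈? xs) * g y)
  ∑-∈?-swap {[]} {ys} _ _ g = sym (∑-zero ys)
  ∑-∈?-swap {x ∷ xs} {ys} (x∉xs ∷ uniqxs) uniqys g = begin
    𝟙 (x ∈? ys) * g x + (∑[ z ∈ xs ] 𝟙 (z ∈? ys) * g z)
      ≡⟨ cong₂ _+_ (sym (∑-select uniqys x g)) (∑-∈?-swap uniqxs uniqys g) ⟩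
    (∑[ y ∈ ys ] 𝟙 (y ≟ x) * g y) + (∑[ y ∈ ys ] 𝟙 (y ∈? xs) * g y)
      ≡⟨ ∑-+ ys ⟨
    (∑[ y ∈ ys ] 𝟙 (y ≟ x) * g y + 𝟙 (y ∈? xs) * g y)
      ≡⟨ ∑-cong ys (λ y _ → *-distribʳ-+ (g y) (𝟙 (y ≟ x)) (𝟙 (y ∈? xs))) ⟨
    (∑[ y ∈ ys ] (𝟙 (y ≟ x) + 𝟙 (y ∈? xs)) * g y)
      ≡⟨ ∑-cong ys (λ y _ → cong (_* g y) (𝟙-∈-∷ (All¬⇒¬Any x∉xs) y)) ⟩
    (∑[ y ∈ ys ] 𝟙 (y ∈? (x ∷ xs)) * g y) ∎
    where open ≡-Reasoning

  ∣∩∣-comm : {xs ys : List A} → Unique xs → Unique ys → ∣ xs ∩ ys ∣ ≡ ∣ ys ∩ xs ∣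
  ∣∩∣-comm {xs} {ys} uniqxs uniqys = begin
    ∣ xs ∩ ys ∣                      ≡⟨ ∑-cong xs (λ x _ → *-identityʳ (𝟙 (x ∈? ys))) ⟨
    (∑[ x ∈ xs ] 𝟙 (x ∈? ys) * 1)   ≡⟨ ∑-∈?-swap uniqxs uniqys (λ _ → 1) ⟩
    (∑[ y ∈ ys ] 𝟙 (y ∈? xs) * 1)   ≡⟨ ∑-cong ys (λ y _ → *-identityʳ (𝟙 (y ∈? xs))) ⟩
    ∣ ys ∩ xs ∣                      ∎
    where open ≡-Reasoning

  ∣∩∩∣-comm : {xs ys : List A} → Unique xs → Unique ys → (zs : List A) →
    ∣ xs ∩ ys ∩ zs ∣ ≡ ∣ ys ∩ xs ∩ zs ∣
  ∣∩∩∣-comm uniqxs uniqys zs = ∑-∈?-swap uniqxs uniqys (λ x → 𝟙 (x ∈? zs))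

  ∣∩∩∣≤∣∩∣ : (xs ys zs : List A) → ∣ xs ∩ ys ∩ zs ∣ ≤ ∣ xs ∩ zs ∣
  ∣∩∩∣≤∣∩∣ xs ys zs = ∑-mono xs (λ x → ≤-trans (*-monoˡ-≤ (𝟙 (x ∈? zs)) (𝟙≤1 (x ∈? ys)))
                                                 (≤-reflexive (*-identityˡ (𝟙 (x ∈? zs)))))

  ∣∩∣+∣∩∣≤ : {xs ys zs : List A} → Unique xs → Unique ys → Unique zs →
    ∣ xs ∩ zs ∣ + ∣ ys ∩ zs ∣ ≤ length zs + ∣ xs ∩ zs ∩ ys ∣
  ∣∩∣+∣∩∣≤ {xs} {ys} {zs} uniqxs uniqys uniqzs = begin
    ∣ xs ∩ zs ∣ + ∣ ys ∩ zs ∣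
      ≡⟨ cong₂ _+_ (∣∩∣-comm uniqxs uniqzs) (∣∩∣-comm uniqys uniqzs) ⟩
    ∣ zs ∩ xs ∣ + ∣ zs ∩ ys ∣
      ≡⟨ ∑-+ zs ⟨
    (∑[ z ∈ zs ] 𝟙 (z ∈? xs) + 𝟙 (z ∈? ys))
      ≤⟨ ∑-mono zs (λ z → 𝟙+𝟙≤1+𝟙*𝟙 (z ∈? xs) (z ∈? ys)) ⟩
    (∑[ z ∈ zs ] 1 + 𝟙 (z ∈? xs) * 𝟙 (z ∈? ys))
      ≡⟨ ∑-+ zs ⟩
    (∑[ z ∈ zs ] 1) + ∣ zs ∩ xs ∩ ys ∣
      ≡⟨ cong₂ _+_ (∑-one zs) (∣∩∩∣-comm uniqzs uniqxs ys) ⟩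
    length zs + ∣ xs ∩ zs ∩ ys ∣ ∎
    where open ≤-Reasoning

n+k≡m⇒m∸2≤n : ∀ {n k m} → k ≤ 2 → n + k ≡ m → m ∸ 2 ≤ n
n+k≡m⇒m∸2≤n {n} {k} k≤2 refl = ≤-trans (∸-monoʳ-≤ (n + k) k≤2) (≤-reflexive (m+n∸n≡m n k))

n+k≡m⇒n≢m∸2 : ∀ {n k m} → k ≤ 1 → 2 ≤ m → n + k ≡ m → n ≢ m ∸ 2
n+k≡m⇒n≢m∸2 {n} {k} k≤1 2≤m refl n≡m∸2 = <⇒≱ (s≤s k≤1) (≤-reflexive (+-cancelˡ-≡ n 2 k n+2≡n+k))
  where
  n+2≡n+k : n + 2 ≡ n + k
  n+2≡n+k = trans (cong (_+ 2) n≡m∸2) (m∸n+n≡m 2≤m)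

n+2≡m⇒n≡m∸2 : ∀ {n m} → n + 2 ≡ m → n ≡ m ∸ 2
n+2≡m⇒n≡m∸2 {n} refl = sym (m+n∸n≡m n 2)

4mn≤[m+n]² : ∀ m n → 4 * (m * n) ≤ (m + n) * (m + n)
4mn≤[m+n]² m n = [ ≤-case , ≥-case ]′ (≤-total m n)
  where

  expand : ∀ m k → (m + (m + k)) * (m + (m + k)) ≡ 4 * (m * (m + k)) + k * k
  expand = solve-∀

  ≤-case : ∀ {m n} → m ≤ n → 4 * (m * n) ≤ (m + n) * (m + n)
  ≤-case {m} m≤n with m≤n⇒∃[o]m+o≡n m≤n
  ... | k , refl = subst (4 * (m * (m + k)) ≤_) (sym (expand m k)) (m≤m+n _ (k * k))

  ≥-case : n ≤ m → 4 * (m * n) ≤ (m + n) * (m + n)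
  ≥-case n≤m = subst₂ (λ s t → 4 * s ≤ t) (*-comm n m) (cong₂ _*_ (+-comm n m) (+-comm n m))
                      (≤-case n≤m)

n²+4t≤[n+t]² : ∀ {n} t → 2 ≤ n → n * n + 4 * t ≤ (n + t) * (n + t)
n²+4t≤[n+t]² {n} t 2≤n = begin
  n * n + 4 * t         ≤⟨ +-monoʳ-≤ (n * n) (*-monoˡ-≤ t (*-monoʳ-≤ 2 2≤n)) ⟩
  n * n + 2 * n * t     ≤⟨ m≤m+n (n * n + 2 * n * t) (t * t) ⟩
  n * n + 2 * n * t + t * t ≡⟨ expand n t ⟨
  (n + t) * (n + t)     ∎
  where
  open ≤-Reasoning
  expand : ∀ n t → (n + t) * (n + t) ≡ n * n + 2 * n * t + t * t
  expand = solve-∀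

4[p+a]≤[a+m]² : ∀ {p x y z a m} → p + z ≡ x * y → x + y ≤ m + z → z ≤ a → 2 ≤ m →
  4 * (p + a) ≤ (a + m) * (a + m)
4[p+a]≤[a+m]² {p} {x} {y} {z} {_} {m} p+z≡xy x+y≤m+z z≤a 2≤m with m≤n⇒∃[o]m+o≡n z≤a
... | t , refl = begin
  4 * (p + (z + t))           ≡⟨ cong (4 *_) (+-assoc p z t) ⟨
  4 * (p + z + t)             ≡⟨ *-distribˡ-+ 4 (p + z) t ⟩
  4 * (p + z) + 4 * t         ≡⟨ cong (λ k → 4 * k + 4 * t) p+z≡xy ⟩
  4 * (x * y) + 4 * t         ≤⟨ +-monoˡ-≤ (4 * t) (4mn≤[m+n]² x y) ⟩
  (x + y) * (x + y) + 4 * t   ≤⟨ +-monoˡ-≤ (4 * t) (*-mono-≤ x+y≤m+z x+y≤m+z) ⟩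
  (m + z) * (m + z) + 4 * t   ≤⟨ n²+4t≤[n+t]² t (≤-trans 2≤m (m≤m+n m z)) ⟩
  (m + z + t) * (m + z + t)   ≡⟨ cong (λ k → k * k) m+z+t≡z+t+m ⟩
  (z + t + m) * (z + t + m)   ∎
  where
  open ≤-Reasoning
  m+z+t≡z+t+m : m + z + t ≡ z + t + m
  m+z+t≡z+t+m = trans (+-assoc m z t) (+-comm m (z + t))

open ListIntersections _≟_
open import Data.List.Membership.DecPropositional _≟_ using (_∈?_)

proper⇒≢u : ∀ {c e d} → IsProper (col c e d) → e ≢ c
proper⇒≢u proper = proper w u tt

proper⇒≢v : ∀ {c e d} → IsProper (col c e d) → e ≢ d
proper⇒≢v proper = proper w v tt

≢⇒proper : ∀ {c e d} → e ≢ c → e ≢ d → IsProper (col c e d)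
≢⇒proper e≢c e≢d zero             (suc zero)       _ = e≢c ∘ sym
≢⇒proper e≢c e≢d (suc zero)       zero             _ = e≢c
≢⇒proper e≢c e≢d (suc zero)       (suc (suc zero)) _ = e≢d
≢⇒proper e≢c e≢d (suc (suc zero)) (suc zero)       _ = e≢d ∘ sym
≢⇒proper _   _   zero             zero             ()
≢⇒proper _   _   zero             (suc (suc zero)) ()
≢⇒proper _   _   (suc zero)       (suc zero)       ()
≢⇒proper _   _   (suc (suc zero)) zero             ()
≢⇒proper _   _   (suc (suc zero)) (suc (suc zero)) ()

𝟙-proper-≢ : ∀ {c d} → c ≢ d → (e : ℕ) → 𝟙 (isProper? (col c e d)) + (𝟙 (e ≟ c) + 𝟙 (e ≟ d)) ≡ 1
𝟙-proper-≢ {c} {d} c≢d e = split (isProper? (col c e d)) (e ≟ c) (e ≟ d)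
  where
  split : (proper? : Dec (IsProper (col c e d))) (e≟c : Dec (e ≡ c)) (e≟d : Dec (e ≡ d)) →
    𝟙 proper? + (𝟙 e≟c + 𝟙 e≟d) ≡ 1
  split _             (yes refl) (yes refl) = ⊥-elim (c≢d refl)
  split (yes proper)  (yes e≡c)  _          = ⊥-elim (proper⇒≢u proper e≡c)
  split (yes proper)  _          (yes e≡d)  = ⊥-elim (proper⇒≢v proper e≡d)
  split (no improper) (no e≢c)   (no e≢d)   = ⊥-elim (improper (≢⇒proper e≢c e≢d))
  split (yes _)       (no _)     (no _)     = refl
  split (no _)        (yes _)    (no _)     = refl
  split (no _)        (no _)     (yes _)    = refl

𝟙-proper-≡ : (c e : ℕ) → 𝟙 (isProper? (col c e c)) + 𝟙 (e ≟ c) ≡ 1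
𝟙-proper-≡ c e = split (isProper? (col c e c)) (e ≟ c)
  where
  split : (proper? : Dec (IsProper (col c e c))) (e≟c : Dec (e ≡ c)) → 𝟙 proper? + 𝟙 e≟c ≡ 1
  split (yes proper)  (yes e≡c) = ⊥-elim (proper⇒≢u proper e≡c)
  split (no improper) (no e≢c)  = ⊥-elim (improper (≢⇒proper e≢c e≢c))
  split (yes _)       (no _)    = refl
  split (no _)        (yes _)   = refl

module _ (L : ListAssignment) (uniqW : Unique (L w)) where

  private
    W : List ℕ
    W = L w

    bad : ℕ → ℕ → ℕ
    bad c d = 𝟙 (N L c d ≟ length W ∸ 2)

  N-≢ : ∀ {c d} → c ≢ d → N L c d + (𝟙 (c ∈? W) + 𝟙 (d ∈? W)) ≡ length W
  N-≢ {c} {d} c≢d = begin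
    N L c d + (𝟙 (c ∈? W) + 𝟙 (d ∈? W))
      ≡⟨ cong₂ _+_ (length-filter≡∑𝟙 _ W) (sym (cong₂ _+_ (count-≟ uniqW c) (count-≟ uniqW d))) ⟩
    (∑[ e ∈ W ] 𝟙 (isProper? (col c e d))) + ((∑[ e ∈ W ] 𝟙 (e ≟ c)) + (∑[ e ∈ W ] 𝟙 (e ≟ d)))
      ≡⟨ cong ((∑[ e ∈ W ] 𝟙 (isProper? (col c e d))) +_) (∑-+ W) ⟨
    (∑[ e ∈ W ] 𝟙 (isProper? (col c e d))) + (∑[ e ∈ W ] 𝟙 (e ≟ c) + 𝟙 (e ≟ d))
      ≡⟨ ∑-+ W ⟨
    (∑[ e ∈ W ] 𝟙 (isProper? (col c e d)) + (𝟙 (e ≟ c) + 𝟙 (e ≟ d)))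
      ≡⟨ ∑-cong W (λ e _ → 𝟙-proper-≢ c≢d e) ⟩
    (∑[ e ∈ W ] 1)
      ≡⟨ ∑-one W ⟩
    length W ∎
    where open ≡-Reasoning

  N-≡ : (c : ℕ) → N L c c + 𝟙 (c ∈? W) ≡ length W
  N-≡ c = begin
    N L c c + 𝟙 (c ∈? W)
      ≡⟨ cong₂ _+_ (length-filter≡∑𝟙 _ W) (sym (count-≟ uniqW c)) ⟩
    (∑[ e ∈ W ] 𝟙 (isProper? (col c e c))) + (∑[ e ∈ W ] 𝟙 (e ≟ c))
      ≡⟨ ∑-+ W ⟨
    (∑[ e ∈ W ] 𝟙 (isProper? (col c e c)) + 𝟙 (e ≟ c))
      ≡⟨ ∑-cong W (λ e _ → 𝟙-proper-≡ c e) ⟩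
    (∑[ e ∈ W ] 1)
      ≡⟨ ∑-one W ⟩
    length W ∎
    where open ≡-Reasoning

  N-bounds : (c d : ℕ) → length W ∸ 2 ≤ N L c d × N L c d ≤ length W
  N-bounds c d with c ≟ d
  ... | yes refl = n+k≡m⇒m∸2≤n (≤-trans (𝟙≤1 (c ∈? W)) (n≤1+n 1)) (N-≡ c)
                 , subst (N L c c ≤_) (N-≡ c) (m≤m+n (N L c c) _)
  ... | no c≢d   = n+k≡m⇒m∸2≤n (+-mono-≤ (𝟙≤1 (c ∈? W)) (𝟙≤1 (d ∈? W))) (N-≢ c≢d)
                 , subst (N L c d ≤_) (N-≢ c≢d) (m≤m+n (N L c d) _)

  module _ (2≤|W| : 2 ≤ length W) where

    N≡∸2⇒ : ∀ {c d} → N L c d ≡ length W ∸ 2 → c ≢ d × c ∈ W × d ∈ W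
    N≡∸2⇒ {c} {d} N≡ with c ≟ d | c ∈? W | d ∈? W
    ... | yes refl | _        | _        = ⊥-elim (n+k≡m⇒n≢m∸2 (𝟙≤1 (c ∈? W)) 2≤|W| (N-≡ c) N≡)
    ... | no c≢d   | yes c∈W  | yes d∈W  = c≢d , c∈W , d∈W
    ... | no c≢d   | no c∉W   | _        = ⊥-elim (n+k≡m⇒n≢m∸2 k≤1 2≤|W| (N-≢ c≢d) N≡)
      where
      k≤1 : 𝟙 (c ∈? W) + 𝟙 (d ∈? W) ≤ 1
      k≤1 = +-mono-≤ (≤-reflexive (𝟙-no (c ∈? W) c∉W)) (𝟙≤1 (d ∈? W))
    ... | no c≢d   | yes _    | no d∉W   = ⊥-elim (n+k≡m⇒n≢m∸2 k≤1 2≤|W| (N-≢ c≢d) N≡)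
      where
      k≤1 : 𝟙 (c ∈? W) + 𝟙 (d ∈? W) ≤ 1
      k≤1 = +-mono-≤ (𝟙≤1 (c ∈? W)) (≤-reflexive (𝟙-no (d ∈? W) d∉W))

    N≡∸2⇐ : ∀ {c d} → c ≢ d → c ∈ W → d ∈ W → N L c d ≡ length W ∸ 2
    N≡∸2⇐ {c} {d} c≢d c∈W d∈W = n+2≡m⇒n≡m∸2
      (subst₂ (λ i j → N L c d + (i + j) ≡ length W) (𝟙-yes (c ∈? W) c∈W) (𝟙-yes (d ∈? W) d∈W)
              (N-≢ c≢d))

    𝟙-bad : (c d : ℕ) → bad c d + 𝟙 (c ∈? W) * 𝟙 (d ≟ c) ≡ 𝟙 (c ∈? W) * 𝟙 (d ∈? W)
    𝟙-bad c d = split (N L c d ≟ length W ∸ 2) (c ∈? W) (d ≟ c) (d ∈? W)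
      where
      split : (bad? : Dec (N L c d ≡ length W ∸ 2)) (c∈?W : Dec (c ∈ W))
              (d≟c : Dec (d ≡ c)) (d∈?W : Dec (d ∈ W)) →
              𝟙 bad? + 𝟙 c∈?W * 𝟙 d≟c ≡ 𝟙 c∈?W * 𝟙 d∈?W
      split (yes _)   (yes _)   (no _)    (yes _)   = refl
      split (yes N≡)  (no c∉W)  _         _         = ⊥-elim (c∉W (proj₁ (proj₂ (N≡∸2⇒ N≡))))
      split (yes N≡)  _         (yes d≡c) _         = ⊥-elim (proj₁ (N≡∸2⇒ N≡) (sym d≡c))
      split (yes N≡)  _         _         (no d∉W)  = ⊥-elim (d∉W (proj₂ (proj₂ (N≡∸2⇒ N≡))))
      split (no _)    (no _)    _         _         = refl
      split (no _)    (yes _)   (yes _)   (yes _)   = refl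
      split (no _)    (yes c∈W) (yes d≡c) (no d∉W)  = ⊥-elim (d∉W (subst (_∈ W) (sym d≡c) c∈W))
      split (no N≢)   (yes c∈W) (no d≢c)  (yes d∈W) = ⊥-elim (N≢ (N≡∸2⇐ (d≢c ∘ sym) c∈W d∈W))
      split (no _)    (yes _)   (no _)    (no _)    = refl

    ∑-bad-row : {B : List ℕ} → Unique B → (c : ℕ) →
      (∑[ d ∈ B ] bad c d) + 𝟙 (c ∈? W) * 𝟙 (c ∈? B) ≡ 𝟙 (c ∈? W) * ∣ B ∩ W ∣
    ∑-bad-row {B} uniqB c = begin
      (∑[ d ∈ B ] bad c d) + 𝟙 (c ∈? W) * 𝟙 (c ∈? B)
        ≡⟨ cong (λ k → (∑[ d ∈ B ] bad c d) + 𝟙 (c ∈? W) * k) (count-≟ uniqB c) ⟨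
      (∑[ d ∈ B ] bad c d) + 𝟙 (c ∈? W) * (∑[ d ∈ B ] 𝟙 (d ≟ c))
        ≡⟨ cong ((∑[ d ∈ B ] bad c d) +_) (∑-*ˡ (λ d → 𝟙 (d ≟ c)) (𝟙 (c ∈? W)) B) ⟨
      (∑[ d ∈ B ] bad c d) + (∑[ d ∈ B ] 𝟙 (c ∈? W) * 𝟙 (d ≟ c))
        ≡⟨ ∑-+ B ⟨
      (∑[ d ∈ B ] bad c d + 𝟙 (c ∈? W) * 𝟙 (d ≟ c))
        ≡⟨ ∑-cong B (λ d _ → 𝟙-bad c d) ⟩
      (∑[ d ∈ B ] 𝟙 (c ∈? W) * 𝟙 (d ∈? W))
        ≡⟨ ∑-*ˡ (λ d → 𝟙 (d ∈? W)) (𝟙 (c ∈? W)) B ⟩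
      𝟙 (c ∈? W) * ∣ B ∩ W ∣ ∎
      where open ≡-Reasoning

    badPairs+∣∩∩∣≡∣∩∣*∣∩∣ : Unique (L v) →
      badPairs (length W) L + ∣ L u ∩ W ∩ L v ∣ ≡ ∣ L u ∩ W ∣ * ∣ L v ∩ W ∣
    badPairs+∣∩∩∣≡∣∩∣*∣∩∣ uniqV = begin
      badPairs (length W) L + ∣ L u ∩ W ∩ L v ∣
        ≡⟨ cong (_+ ∣ L u ∩ W ∩ L v ∣) (trans (length-filter≡∑𝟙 _ (cartesianProduct (L u) (L v)))
                                              (∑-cartesianProduct _ (L u) (L v))) ⟩
      (∑[ c ∈ L u ] ∑[ d ∈ L v ] bad c d) + ∣ L u ∩ W ∩ L v ∣
        ≡⟨ ∑-+ (L u) ⟨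
      (∑[ c ∈ L u ] (∑[ d ∈ L v ] bad c d) + 𝟙 (c ∈? W) * 𝟙 (c ∈? L v))
        ≡⟨ ∑-cong (L u) (λ c _ → ∑-bad-row uniqV c) ⟩
      (∑[ c ∈ L u ] 𝟙 (c ∈? W) * ∣ L v ∩ W ∣)
        ≡⟨ ∑-*ʳ (λ c → 𝟙 (c ∈? W)) ∣ L v ∩ W ∣ (L u) ⟩
      ∣ L u ∩ W ∣ * ∣ L v ∩ W ∣ ∎
      where open ≡-Reasoning

mainTheorem10 : (m : ℕ) → (L : ListAssignment) → 3 ≤ m → IsMAssignment m L →
    ((c d : ℕ) → c ∈ L u → d ∈ L v → (m ∸ 2 ≤ N L c d) × (N L c d ≤ m))
    × (4 * (badPairs m L + commonCount L) ≤ (commonCount L + m) * (commonCount L + m))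
mainTheorem10 m L 3≤m isM with isM u | isM v | isM w
... | uniqU , _ | uniqV , _ | uniqW , refl =
  (λ c d _ _ → N-bounds L uniqW c d) ,
  subst (λ a → 4 * (badPairs m L + a) ≤ (a + m) * (a + m))
        (sym (length-filter≡∑𝟙 (_∈? L v) (L u)))
        (4[p+a]≤[a+m]² {x = ∣ L u ∩ L w ∣} {y = ∣ L v ∩ L w ∣}
                       (badPairs+∣∩∩∣≡∣∩∣*∣∩∣ L uniqW 2≤m uniqV)
                       (∣∩∣+∣∩∣≤ uniqU uniqV uniqW)
                       (∣∩∩∣≤∣∩∣ (L u) (L w) (L v))
                       2≤m)
  where
  2≤m : 2 ≤ m
  2≤m = <⇒≤ 3≤m
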